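{- Let $n\geq 2$ and let $(F_0,F_1,F_2,F_3)$ be a type-I 2-factorization of $\vec{C}_n\wr\vec{C}_3$, where for $j\in\{0,1,2\}$ the type-1 2-factor $F_j$ contains the arc $(0_j,0_{j+1})$ and $F_3$ is the type-0 2-factor. For $i\in\mathbb{Z}_n$ define $g^{(i)}=((a^i_0,a^i_1,a^i_2),(\sigma_i,\gamma_i))\in\Gamma$ as in the context, and let $(g_1,g_2)=g^{(0)}g^{(1)}\cdots g^{(n-1)}$ (product in $\Gamma$). If $\{F_0,F_1,F_2,F_3\}$ is a hamiltonian decomposition of $\vec{C}_n\wr\vec{C}_3$ (i.e. each $F_j$ is a directed hamiltonian cycle), then $(g_1,g_2)\in\{((1,1,1),(\mathrm{id},(0\,1\,2))),\ ((1,1,1),(\mathrm{id},(0\,2\,1)))\}$.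
   Context: Let $V(\vec{C}_n)=\mathbb{Z}_n$ with arcs $(i,i+1)$ and $V(\vec{C}_3)=\mathbb{Z}_3$ with arcs $(j,j+1)$; $\vec{C}_n\wr\vec{C}_3$ has vertex set $\mathbb{Z}_n\times\mathbb{Z}_3$, with $((g_1,h_1),(g_2,h_2))$ an arc iff $g_2=g_1+1$, or $g_1=g_2$ and $h_2=h_1+1$. Write $i_j$ for $(i,j)$, $V_i=\{i_0,i_1,i_2\}$, and $C^i_3$ for the directed 3-cycle $i_0\,i_1\,i_2\,i_0$. A directed 2-factor is a spanning subdigraph that is a vertex-disjoint union of directed cycles; it is of type $k$ if it contains exactly $k$ arcs of $C^i_3$ for every $i$. A type-I 2-factorization is a partition of the arc set into four directed 2-factors, three of type 1 and one of type 0. Permutations of $\mathbb{Z}_3$ act on the right and are composed left to right. For a 2-factor $F$ and $i\in\mathbb{Z}_n$, $F[i]$ is the subdigraph on $V_i\cup V_{i+1}$ consisting of arcs of $F$ lying in $C^i_3$, $C^{i+1}_3$, or going from $V_i$ to $V_{i+1}$; a type-1 factor $F$ has $F[i]$ equal to a union of two disjoint dipaths of total length 4, and $F$ is switched at $i$ if both have length 2. For $i\in\mathbb{Z}_n$ and $j\in\{0,1,2\}$, let $k_{(i,j)}$ be such that $F_j$ contains $(i_{k_{(i,j)}},i_{k_{(i,j)}+1})$; $\sigma_i$ is the permutation of $\mathbb{Z}_3$ with $(k_{(i,j)})^{\sigma_i}=k_{(i+1,j)}$. Since $F_3$ is of type 0, its arcs with tail in $V_i$ are $(i_j,(i+1)_{j^{\gamma_i}})$,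 $j\in\mathbb{Z}_3$, for a unique permutation $\gamma_i$ of $\mathbb{Z}_3$. For $k\in\mathbb{Z}_3$, $a^i_k=1$ if the type-1 factor among $F_0,F_1,F_2$ containing the arc $(i_k,i_{k+1})$ is switched at $i$, and $a^i_k=0$ otherwise. $\Gamma$ is the group with underlying set $\mathbb{Z}_2^3\times(S_3\times S_3)$ and multiplication $((a_0,a_1,a_2),(\sigma,\gamma))\cdot((b_0,b_1,b_2),(\sigma',\gamma'))=((a_0+b_{0^\sigma},a_1+b_{1^\sigma},a_2+b_{2^\sigma}),(\sigma\sigma',\gamma\gamma'))$, with addition in $\mathbb{Z}_2$ (the semidirect product $\mathbb{Z}_2^3\rtimes(S_3\oplus S_3)$ in which $(\sigma,\gamma)$ acts by permuting coordinates via $\sigma$). -}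

module Defs where

open import Data.Nat using (ℕ; zero; suc)
open import Data.Nat.DivMod using (_mod_)
open import Data.Fin using (Fin; zero; suc; toℕ)
open import Data.Bool using (Bool; true; false; _xor_)
open import Data.Product using (Σ; _×_; _,_; proj₁; proj₂)
open import Data.Sum using (_⊎_)
open import Data.Empty using (⊥)
open import Data.List using (List; []; _∷_; foldr; map; allFin)
open import Data.List.Relation.Unary.Unique.Propositional using (Unique)
open import Function.Definitions using (Injective)
open import Relation.Binary.PropositionalEquality using (_≡_)

inc : ∀ {n} → Fin n → Fin n
inc {suc m} i = suc (toℕ i) mod suc m

suc3 : Fin 3 → Fin 3
suc3 zero = suc zero
suc3 (suc zero) = suc (suc zero)
suc3 (suc (suc zero)) = zero

-- vertex i_j is the pair (i , j)
Vtx : ℕ → Set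
Vtx n = Fin n × Fin 3

Arc : ∀ {n} → Vtx n → Vtx n → Set
Arc (g₁ , h₁) (g₂ , h₂) = (g₂ ≡ inc g₁) ⊎ ((g₁ ≡ g₂) × (h₂ ≡ suc3 h₁))

-- A spanning subdigraph in which every vertex has
-- out-degree 1 is given by its successor function s (arc set
-- {(v , s v)}); it is a vertex-disjoint union of directed cycles iff
-- moreover s is injective (every in-degree is 1).

IsTwoFactor : ∀ {n} → (Vtx n → Vtx n) → Set
IsTwoFactor s = (∀ v → Arc v (s v)) × Injective _≡_ _≡_ s

iter : ∀ {A : Set} → (A → A) → ℕ → A → A
iter f zero x = x
iter f (suc m) x = f (iter f m x)

IsHamiltonian : ∀ {n} → (Vtx n → Vtx n) → Set
IsHamiltonian s = ∀ x y → Σ ℕ λ m → iter s m x ≡ y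

TypeZero : ∀ {n} → (Vtx n → Vtx n) → Set
TypeZero {n} s = ∀ (i : Fin n) (j : Fin 3) → s (i , j) ≡ (i , suc3 j) → ⊥

TypeOne : ∀ {n} → (Vtx n → Vtx n) → Set
TypeOne {n} s = ∀ (i : Fin n) →
  Σ (Fin 3) λ j → (s (i , j) ≡ (i , suc3 j)) ×
    (∀ j′ → s (i , j′) ≡ (i , suc3 j′) → j′ ≡ j)

-- four 2-factors partition the arc set: every arc lies in exactly one
-- of them (the arcs of each factor are arcs of the digraph by IsTwoFactor)
IsArcPartition : ∀ {n} → (Fin 4 → Vtx n → Vtx n) → Set
IsArcPartition {n} F = ∀ (x y : Vtx n) → Arc x y →
  Σ (Fin 4) λ j → (F j x ≡ y) × (∀ j′ → F j′ x ≡ y → j′ ≡ j)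

InSub : ∀ {n} → (Vtx n → Vtx n) → Fin n → Vtx n → Vtx n → Set
InSub s i x y = (s x ≡ y) ×
  ( ((proj₁ x ≡ i) × (proj₁ y ≡ i) × (proj₂ y ≡ suc3 (proj₂ x)))
  ⊎ ((proj₁ x ≡ inc i) × (proj₁ y ≡ inc i) × (proj₂ y ≡ suc3 (proj₂ x)))
  ⊎ ((proj₁ x ≡ i) × (proj₁ y ≡ inc i)) )

Switched : ∀ {n} → (Vtx n → Vtx n) → Fin n → Set
Switched {n} s i =
  Σ (Vtx n) λ u₀ → Σ (Vtx n) λ u₁ → Σ (Vtx n) λ u₂ →
  Σ (Vtx n) λ w₀ → Σ (Vtx n) λ w₁ → Σ (Vtx n) λ w₂ →
  Unique (u₀ ∷ u₁ ∷ u₂ ∷ w₀ ∷ w₁ ∷ w₂ ∷ []) ×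
  (∀ x y → (InSub s i x y →
              ((x ≡ u₀) × (y ≡ u₁)) ⊎ ((x ≡ u₁) × (y ≡ u₂))
            ⊎ ((x ≡ w₀) × (y ≡ w₁)) ⊎ ((x ≡ w₁) × (y ≡ w₂)))
         × ((((x ≡ u₀) × (y ≡ u₁)) ⊎ ((x ≡ u₁) × (y ≡ u₂))
            ⊎ ((x ≡ w₀) × (y ≡ w₁)) ⊎ ((x ≡ w₁) × (y ≡ w₂)))
              → InSub s i x y))

-- The group Γ = ℤ₂³ ⋊ (S₃ ⊕ S₃)
-- ℤ₂ = Bool (true = 1, addition = xor); a permutation of ℤ₃ is
-- represented by its map x ↦ x^σ (right action, so σσ′ = σ′ ∘ σ).

record Γ : Set where
  constructor ⟨_,_,_⟩
  field
    vec : Fin 3 → Bool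
    sig : Fin 3 → Fin 3
    gam : Fin 3 → Fin 3
open Γ public

infixl 7 _·_
_·_ : Γ → Γ → Γ
⟨ a , σ , γ ⟩ · ⟨ b , σ′ , γ′ ⟩ =
  ⟨ (λ k → a k xor b (σ k)) , (λ x → σ′ (σ x)) , (λ x → γ′ (γ x)) ⟩

e : Γ
e = ⟨ (λ _ → false) , (λ x → x) , (λ x → x) ⟩

prodΓ : (n : ℕ) → (Fin n → Γ) → Γ
prodΓ n g = foldr _·_ e (map g (allFin n))

IsTargetElement : Γ → Set
IsTargetElement ⟨ a , σ , γ ⟩ =
  (∀ k → a k ≡ true) × (∀ x → σ x ≡ x) ×
  ((∀ x → γ x ≡ suc3 x) ⊎ (∀ x → γ x ≡ suc3 (suc3 x)))

-- The σ-part of the product carries k_(0,j) = j along the chain σ_i(k_(i,j)) = k_(i+1,j)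
-- back to k_(n,j) = j, so it is the identity. The γ-part is the holonomy γ_{n-1}∘⋯∘γ_0 of F₃
-- around the layers; if it fixed x, the F₃-walk from 0_x would meet layer 0 only in 0_x and
-- never reach 0_{x+1}, so it is a fixed-point-free permutation of ℤ₃, i.e. a 3-cycle.
-- The j-th vector entry is the parity of the number of layers at which F_j is switched.
-- Inside each layer F_j runs along two strands, and entering the next layer keeps the
-- strands at unswitched layers and exchanges them at switched ones. With even parity the
-- strand of a vertex would therefore be invariant along F_j, and the cycle through 0_j
-- could never reach 0_{j+2}, which lies on the other strand.
{-# OPTIONS --safe #-}
module Submission where

open import Defs
open import Data.Nat using (ℕ; zero; suc; _%_; _/_; _+_; _*_)
open import Data.Nat.Properties using (suc-injective; 0≢1+n; 1+n≢n; m≤n⇒m<n∨m≡n)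
open import Data.Nat.DivMod using (_mod_; m<n⇒m%n≡m; n%n≡0; %-congˡ; m≡m%n+[m/n]*n; [m+kn]%n≡m%n)
open import Data.Fin using (Fin; zero; suc; toℕ; inject₁)
open import Data.Fin.Patterns using (0F; 1F; 2F; 3F; 4F; 5F)
open import Data.Fin.Properties using (toℕ-injective; toℕ-fromℕ<; toℕ<n)
open import Data.Bool using (Bool; true; false; _xor_)
open import Data.Bool.Properties using (xor-assoc; xor-identityʳ; ¬-not; not-¬)
open import Data.Product using (∃₂; _×_; _,_; proj₁; proj₂)
open import Data.Product.Properties using (,-injectiveˡ; ,-injectiveʳ)
open import Data.Sum using (_⊎_; inj₁; inj₂)
import Data.Sum as Sum
open import Data.Empty using (⊥; ⊥-elim)
open import Data.List using (List; []; _∷_; foldr; map; allFin; tabulate; applyUpTo; lookup)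
open import Data.List.Properties using (map-tabulate; tabulate-cong)
open import Data.List.Membership.Propositional.Properties using (∈-lookup)
open import Data.List.Relation.Unary.Unique.Propositional using (Unique)
import Data.List.Relation.Unary.All as All
open All using ([]; _∷_)
open import Data.List.Relation.Unary.AllPairs using ([]; _∷_)
open import Function using (_∘_; id)
open import Function.Definitions using (Injective)
open import Relation.Nullary using (¬_)
open import Relation.Binary.PropositionalEquality
  using (_≡_; _≢_; refl; sym; trans; cong; cong₂; subst; ≢-sym; module ≡-Reasoning)

open ≡-Reasoning

suc3-≢ : ∀ x → suc3 x ≢ x
suc3-≢ 0F ()
suc3-≢ 1F ()
suc3-≢ 2F ()

suc3²-≢ : ∀ x → suc3 (suc3 x) ≢ x
suc3²-≢ 0F ()
suc3²-≢ 1F ()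
suc3²-≢ 2F ()

suc3-cases : ∀ k c → c ≡ k ⊎ c ≡ suc3 k ⊎ c ≡ suc3 (suc3 k)
suc3-cases 0F 0F = inj₁ refl
suc3-cases 0F 1F = inj₂ (inj₁ refl)
suc3-cases 0F 2F = inj₂ (inj₂ refl)
suc3-cases 1F 0F = inj₂ (inj₂ refl)
suc3-cases 1F 1F = inj₁ refl
suc3-cases 1F 2F = inj₂ (inj₁ refl)
suc3-cases 2F 0F = inj₂ (inj₁ refl)
suc3-cases 2F 1F = inj₂ (inj₂ refl)
suc3-cases 2F 2F = inj₁ refl

Rotation : (Fin 3 → Fin 3) → Set
Rotation p = (∀ x → p x ≡ suc3 x) ⊎ (∀ x → p x ≡ suc3 (suc3 x))

fixedPointFree⇒rotation : (p : Fin 3 → Fin 3) → Injective _≡_ _≡_ p → (∀ x → p x ≢ x) →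
                          Rotation p
fixedPointFree⇒rotation p injective fixedPointFree = by-values (p 0F) (p 1F) (p 2F) refl refl refl
  where
  collide : ∀ x y → x ≢ y → p x ≢ p y
  collide _ _ x≢y = x≢y ∘ injective

  by-values : ∀ a b c → p 0F ≡ a → p 1F ≡ b → p 2F ≡ c → Rotation p
  by-values 1F 2F 0F e₀ e₁ e₂ = inj₁ λ { 0F → e₀ ; 1F → e₁ ; 2F → e₂ }
  by-values 2F 0F 1F e₀ e₁ e₂ = inj₂ λ { 0F → e₀ ; 1F → e₁ ; 2F → e₂ }
  by-values 0F _ _ e₀ _ _ = ⊥-elim (fixedPointFree 0F e₀)
  by-values _ 1F _ _ e₁ _ = ⊥-elim (fixedPointFree 1F e₁)
  by-values _ _ 2F _ _ e₂ = ⊥-elim (fixedPointFree 2F e₂)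
  by-values 1F 0F 0F _ e₁ e₂ = ⊥-elim (collide 1F 2F (λ ()) (trans e₁ (sym e₂)))
  by-values 2F 0F 0F _ e₁ e₂ = ⊥-elim (collide 1F 2F (λ ()) (trans e₁ (sym e₂)))
  by-values 1F 0F 1F e₀ _ e₂ = ⊥-elim (collide 0F 2F (λ ()) (trans e₀ (sym e₂)))
  by-values 1F 2F 1F e₀ _ e₂ = ⊥-elim (collide 0F 2F (λ ()) (trans e₀ (sym e₂)))
  by-values 2F 2F _ e₀ e₁ _ = ⊥-elim (collide 0F 1F (λ ()) (trans e₀ (sym e₁)))

-- In a layer V_i where the C₃-arc of a type-1 factor is k → k+1, the factor
-- passes through V_i along two strands, k → k+1 and the lone vertex k+2;
-- strand k c is true exactly on the lone vertex.
strand : Fin 3 → Fin 3 → Bool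
strand 0F 2F = true
strand 1F 0F = true
strand 2F 1F = true
strand _ _ = false

strand-self : ∀ k → strand k k ≡ false
strand-self 0F = refl
strand-self 1F = refl
strand-self 2F = refl

strand-suc3 : ∀ k → strand k (suc3 k) ≡ false
strand-suc3 0F = refl
strand-suc3 1F = refl
strand-suc3 2F = refl

strand-suc3² : ∀ k → strand k (suc3 (suc3 k)) ≡ true
strand-suc3² 0F = refl
strand-suc3² 1F = refl
strand-suc3² 2F = refl

module _ {n : ℕ} where

  private
    N : ℕ
    N = suc n

  toℕ-mod : (i : Fin N) → toℕ i mod N ≡ i
  toℕ-mod i = toℕ-injective (trans (toℕ-fromℕ< _) (m<n⇒m%n≡m (toℕ<n i)))

  inc-mod : ∀ t → inc (t mod N) ≡ suc t mod N
  inc-mod t = toℕ-injective (begin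
    toℕ (inc (t mod N))             ≡⟨ toℕ-fromℕ< _ ⟩
    suc (toℕ (t mod N)) % N         ≡⟨ cong (λ r → suc r % N) (toℕ-fromℕ< _) ⟩
    suc (t % N) % N                 ≡⟨ [m+kn]%n≡m%n (suc (t % N)) (t / N) N ⟨
    (suc (t % N) + t / N * N) % N   ≡⟨ %-congˡ {o = N} (cong suc (m≡m%n+[m/n]*n t N)) ⟨
    suc t % N                       ≡⟨ toℕ-fromℕ< _ ⟨
    toℕ (suc t mod N)               ∎)

  n-mod-n≡0 : N mod N ≡ 0F
  n-mod-n≡0 = toℕ-injective (trans (toℕ-fromℕ< _) (n%n≡0 N))

  inc-cases : (i : Fin N) → toℕ (inc i) ≡ suc (toℕ i) ⊎ (inc i ≡ 0F × toℕ i ≡ n)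
  inc-cases i with m≤n⇒m<n∨m≡n (toℕ<n i)
  ... | inj₁ below = inj₁ (trans (toℕ-fromℕ< _) (m<n⇒m%n≡m {n = N} below))
  ... | inj₂ last  = inj₂ (wraps , suc-injective last)
    where
    wraps : inc i ≡ 0F
    wraps = toℕ-injective (trans (toℕ-fromℕ< _) (trans (%-congˡ {o = N} last) (n%n≡0 N)))

  periodic-toℕ-inc : ∀ {A : Set} (f : ℕ → A) → f N ≡ f 0 →
                     ∀ i → f (suc (toℕ i)) ≡ f (toℕ (inc i))
  periodic-toℕ-inc f period i with inc-cases i
  ... | inj₁ steps = cong f (sym steps)
  ... | inj₂ (wraps , last) = begin
    f (suc (toℕ i))  ≡⟨ cong (f ∘ suc) last ⟩
    f N              ≡⟨ period ⟩
    f 0              ≡⟨ cong (f ∘ toℕ) wraps ⟨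
    f (toℕ (inc i))  ∎

≢-inc : ∀ {m} (i : Fin (suc (suc m))) → i ≢ inc i
≢-inc i i≡inc with inc-cases i
... | inj₁ steps = 1+n≢n (sym (trans (cong toℕ i≡inc) steps))
... | inj₂ (wraps , last) = 0≢1+n (trans (sym (cong toℕ (trans i≡inc wraps))) last)

module _ {A : Set} where

  lookup-injective : ∀ {xs : List A} → Unique xs → ∀ {i j} → lookup xs i ≡ lookup xs j → i ≡ j
  lookup-injective (_ ∷ _)  {zero}  {zero}  _  = refl
  lookup-injective (x∉ ∷ _) {zero}  {suc j} eq = ⊥-elim (All.lookup x∉ (∈-lookup j) eq)
  lookup-injective (x∉ ∷ _) {suc i} {zero}  eq = ⊥-elim (All.lookup x∉ (∈-lookup i) (sym eq))
  lookup-injective (_ ∷ u)  {suc i} {suc j} eq = cong suc (lookup-injective u eq)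

data DipathArc : Fin 6 → Fin 6 → Set where
  u₀u₁ : DipathArc 0F 1F
  u₁u₂ : DipathArc 1F 2F
  w₀w₁ : DipathArc 3F 4F
  w₁w₂ : DipathArc 4F 5F

no-three-consecutive : ∀ {a b c d} → DipathArc a b → DipathArc b c → DipathArc c d → ⊥
no-three-consecutive u₀u₁ u₁u₂ ()
no-three-consecutive u₁u₂ ()
no-three-consecutive w₀w₁ w₁w₂ ()
no-three-consecutive w₁w₂ ()

module _ {A : Set} {u₀ u₁ u₂ w₀ w₁ w₂ : A} where

  TwoDipaths : A → A → Set
  TwoDipaths x y = (x ≡ u₀ × y ≡ u₁) ⊎ (x ≡ u₁ × y ≡ u₂)
                 ⊎ (x ≡ w₀ × y ≡ w₁) ⊎ (x ≡ w₁ × y ≡ w₂)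

  private
    vertices : List A
    vertices = u₀ ∷ u₁ ∷ u₂ ∷ w₀ ∷ w₁ ∷ w₂ ∷ []

  arc-positions : ∀ {x y} → TwoDipaths x y →
    ∃₂ λ a b → DipathArc a b × x ≡ lookup vertices a × y ≡ lookup vertices b
  arc-positions (inj₁ (x≡ , y≡))               = 0F , 1F , u₀u₁ , x≡ , y≡
  arc-positions (inj₂ (inj₁ (x≡ , y≡)))        = 1F , 2F , u₁u₂ , x≡ , y≡
  arc-positions (inj₂ (inj₂ (inj₁ (x≡ , y≡)))) = 3F , 4F , w₀w₁ , x≡ , y≡
  arc-positions (inj₂ (inj₂ (inj₂ (x≡ , y≡)))) = 4F , 5F , w₁w₂ , x≡ , y≡

  no-walk-of-length-3 : Unique vertices → ∀ {p q r t} →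
                        TwoDipaths p q → TwoDipaths q r → TwoDipaths r t → ⊥
  no-walk-of-length-3 distinct pq qr rt
    with arc-positions pq | arc-positions qr | arc-positions rt
  ... | _ , b , a₁ , _ , q₁ | b′ , c , a₂ , q₂ , r₂ | c′ , _ , a₃ , r₃ , _
    with lookup-injective distinct {b} {b′} (trans (sym q₁) q₂)
       | lookup-injective distinct {c} {c′} (trans (sym r₂) r₃)
  ... | refl | refl = no-three-consecutive a₁ a₂ a₃

xorUpTo : (ℕ → Bool) → ℕ → Bool
xorUpTo f zero    = false
xorUpTo f (suc t) = xorUpTo f t xor f t

composeUpTo : {A : Set} → (ℕ → A → A) → ℕ → A → A
composeUpTo f zero    x = x
composeUpTo f (suc t) x = f t (composeUpTo f t x)

composeUpTo-injective : ∀ {A : Set} {f : ℕ → A → A} → (∀ t → Injective _≡_ _≡_ (f t)) →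
                        ∀ t → Injective _≡_ _≡_ (composeUpTo f t)
composeUpTo-injective injective zero    eq = eq
composeUpTo-injective injective (suc t) eq = composeUpTo-injective injective t (injective t eq)

prodUpTo : (ℕ → Γ) → ℕ → Γ
prodUpTo h t = foldr _·_ e (applyUpTo h t)

tabulate-∘toℕ : ∀ {A : Set} (f : ℕ → A) n → tabulate {n = n} (f ∘ toℕ) ≡ applyUpTo f n
tabulate-∘toℕ f zero    = refl
tabulate-∘toℕ f (suc n) = cong (f 0 ∷_) (tabulate-∘toℕ (f ∘ suc) n)

prodΓ≡prodUpTo : ∀ n (g : Fin (suc n) → Γ) →
                 prodΓ (suc n) g ≡ prodUpTo (λ t → g (t mod suc n)) (suc n)
prodΓ≡prodUpTo n g = cong (foldr _·_ e) (begin
  map g (allFin (suc n))                 ≡⟨ map-tabulate id g ⟩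
  tabulate g                             ≡⟨ tabulate-cong (λ i → cong g (sym (toℕ-mod i))) ⟩
  tabulate (λ i → g (toℕ i mod suc n))   ≡⟨ tabulate-∘toℕ (λ t → g (t mod suc n)) (suc n) ⟩
  applyUpTo (λ t → g (t mod suc n)) (suc n) ∎)

sig-prodUpTo-suc : ∀ h t x → sig (prodUpTo h (suc t)) x ≡ sig (h t) (sig (prodUpTo h t) x)
sig-prodUpTo-suc h zero    x = refl
sig-prodUpTo-suc h (suc t) x = sig-prodUpTo-suc (h ∘ suc) t (sig (h 0) x)

gam-prodUpTo-suc : ∀ h t x → gam (prodUpTo h (suc t)) x ≡ gam (h t) (gam (prodUpTo h t) x)
gam-prodUpTo-suc h zero    x = refl
gam-prodUpTo-suc h (suc t) x = gam-prodUpTo-suc (h ∘ suc) t (gam (h 0) x)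

vec-prodUpTo-suc : ∀ h t x →
  vec (prodUpTo h (suc t)) x ≡ vec (prodUpTo h t) x xor vec (h t) (sig (prodUpTo h t) x)
vec-prodUpTo-suc h zero    x = xor-identityʳ (vec (h 0) x)
vec-prodUpTo-suc h (suc t) x = begin
  vec (h 0) x xor vec (prodUpTo (h ∘ suc) (suc t)) y
    ≡⟨ cong (vec (h 0) x xor_) (vec-prodUpTo-suc (h ∘ suc) t y) ⟩
  vec (h 0) x xor (vec (prodUpTo (h ∘ suc) t) y xor vec (h (suc t)) (sig (prodUpTo (h ∘ suc) t) y))
    ≡⟨ xor-assoc (vec (h 0) x) _ _ ⟨
  vec (prodUpTo h (suc t)) x xor vec (h (suc t)) (sig (prodUpTo h (suc t)) x) ∎
  where
  y : Fin 3
  y = sig (h 0) x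

gam-prodUpTo : ∀ h t x → gam (prodUpTo h t) x ≡ composeUpTo (gam ∘ h) t x
gam-prodUpTo h zero    x = refl
gam-prodUpTo h (suc t) x = trans (gam-prodUpTo-suc h t x) (cong (gam (h t)) (gam-prodUpTo h t x))

module _ (h : ℕ → Γ) (κ : ℕ → Fin 3 → Fin 3)
         (chain : ∀ t x → sig (h t) (κ t x) ≡ κ (suc t) x) where

  sig-prodUpTo-chain : ∀ t x → sig (prodUpTo h t) (κ 0 x) ≡ κ t x
  sig-prodUpTo-chain zero    x = refl
  sig-prodUpTo-chain (suc t) x = begin
    sig (prodUpTo h (suc t)) (κ 0 x)       ≡⟨ sig-prodUpTo-suc h t (κ 0 x) ⟩
    sig (h t) (sig (prodUpTo h t) (κ 0 x)) ≡⟨ cong (sig (h t)) (sig-prodUpTo-chain t x) ⟩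
    sig (h t) (κ t x)                      ≡⟨ chain t x ⟩
    κ (suc t) x                            ∎

  vec-prodUpTo-chain : ∀ t x → vec (prodUpTo h t) (κ 0 x) ≡ xorUpTo (λ u → vec (h u) (κ u x)) t
  vec-prodUpTo-chain zero    x = refl
  vec-prodUpTo-chain (suc t) x = begin
    vec (prodUpTo h (suc t)) (κ 0 x)
      ≡⟨ vec-prodUpTo-suc h t (κ 0 x) ⟩
    vec (prodUpTo h t) (κ 0 x) xor vec (h t) (sig (prodUpTo h t) (κ 0 x))
      ≡⟨ cong₂ _xor_ (vec-prodUpTo-chain t x) (cong (vec (h t)) (sig-prodUpTo-chain t x)) ⟩
    xorUpTo (λ u → vec (h u) (κ u x)) (suc t) ∎

hamiltonian-invariant : ∀ {n} {s : Vtx n → Vtx n} → IsHamiltonian s → (P : Vtx n → Set) →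
                        (∀ v → P v → P (s v)) → ∀ x y → P x → P y
hamiltonian-invariant {s = s} hamiltonian P step x y Px with hamiltonian x y
... | steps , refl = iterate steps
  where
  iterate : ∀ r → P (iter s r x)
  iterate zero    = Px
  iterate (suc r) = step _ (iterate r)

module TypeOneLayer {m} (s : Vtx (suc (suc m)) → Vtx (suc (suc m))) (two-factor : IsTwoFactor s)
  (i : Fin (suc (suc m))) {k k′ : Fin 3}
  (inner : s (i , k) ≡ (i , suc3 k))
  (inner-unique : ∀ c → s (i , c) ≡ (i , suc3 c) → c ≡ k)
  (inner′ : s (inc i , k′) ≡ (inc i , suc3 k′))
  (inner′-unique : ∀ c → s (inc i , c) ≡ (inc i , suc3 c) → c ≡ k′)
  where

  private
    arc : ∀ v → Arc v (s v)
    arc = proj₁ two-factor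

    injective : Injective _≡_ _≡_ s
    injective = proj₂ two-factor

    layers-differ : ∀ {c d : Fin 3} → (i , c) ≢ (inc i , d)
    layers-differ = ≢-inc i ∘ ,-injectiveˡ

    positions-differ : ∀ {x : Fin (suc (suc m))} {c d : Fin 3} → c ≢ d → (x , c) ≢ (x , d)
    positions-differ c≢d = c≢d ∘ ,-injectiveʳ

  cross : Fin 3 → Fin 3
  cross c = proj₂ (s (i , c))

  cross-arc : ∀ c → c ≢ k → s (i , c) ≡ (inc i , cross c)
  cross-arc c c≢k with arc (i , c)
  ... | inj₁ next           = cong (_, cross c) next
  ... | inj₂ (same , succ) = ⊥-elim (c≢k (inner-unique c (cong₂ _,_ (sym same) succ)))

  cross-arc-to : ∀ c {d} → c ≢ k → cross c ≡ d → s (i , c) ≡ (inc i , d)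
  cross-arc-to c c≢k refl = cross-arc c c≢k

  cross-lands : ∀ c → c ≢ k → cross c ≡ k′ ⊎ cross c ≡ suc3 (suc3 k′)
  cross-lands c c≢k with suc3-cases k′ (cross c)
  ... | inj₁ start          = inj₁ start
  ... | inj₂ (inj₂ last)    = inj₂ last
  ... | inj₂ (inj₁ middle)  = ⊥-elim (layers-differ (injective (begin
    s (i , c)             ≡⟨ cross-arc c c≢k ⟩
    (inc i , cross c)     ≡⟨ cong (inc i ,_) middle ⟩
    (inc i , suc3 k′)     ≡⟨ inner′ ⟨
    s (inc i , k′)        ∎)))

  cross-distinct : cross (suc3 k) ≢ cross (suc3 (suc3 k))
  cross-distinct eq = suc3-≢ (suc3 k) (sym (,-injectiveʳ (injective (begin
    s (i , suc3 k)                  ≡⟨ cross-arc (suc3 k) (suc3-≢ k) ⟩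
    (inc i , cross (suc3 k))        ≡⟨ cong (inc i ,_) eq ⟩
    (inc i , cross (suc3 (suc3 k))) ≡⟨ cross-arc (suc3 (suc3 k)) (suc3²-≢ k) ⟨
    s (i , suc3 (suc3 k))           ∎))))

  -- The cross arcs leaving k+1 and k+2 land on k′ and k′+2 (k′+1 is entered from k′), and
  -- either keep or exchange the two strands; F is switched at i exactly when they exchange.
  Straight Crossed : Set
  Straight = cross (suc3 k) ≡ k′ × cross (suc3 (suc3 k)) ≡ suc3 (suc3 k′)
  Crossed  = cross (suc3 k) ≡ suc3 (suc3 k′) × cross (suc3 (suc3 k)) ≡ k′

  straight-or-crossed : Straight ⊎ Crossed
  straight-or-crossed
    with cross-lands (suc3 k) (suc3-≢ k) | cross-lands (suc3 (suc3 k)) (suc3²-≢ k)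
  ... | inj₁ p | inj₂ q = inj₁ (p , q)
  ... | inj₂ p | inj₁ q = inj₂ (p , q)
  ... | inj₁ p | inj₁ q = ⊥-elim (cross-distinct (trans p (sym q)))
  ... | inj₂ p | inj₂ q = ⊥-elim (cross-distinct (trans p (sym q)))

  straight⇒¬switched : Straight → ¬ Switched s i
  straight⇒¬switched (straight , _) (_ , _ , _ , _ , _ , _ , distinct , arcs) =
    no-walk-of-length-3 distinct (proj₁ (arcs _ _) inner-k) (proj₁ (arcs _ _) cross-k)
                                 (proj₁ (arcs _ _) inner-k′)
    where
    inner-k : InSub s i (i , k) (i , suc3 k)
    inner-k = inner , inj₁ (refl , refl , refl)
    cross-k : InSub s i (i , suc3 k) (inc i , k′)
    cross-k = cross-arc-to (suc3 k) (suc3-≢ k) straight , inj₂ (inj₂ (refl , refl))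
    inner-k′ : InSub s i (inc i , k′) (inc i , suc3 k′)
    inner-k′ = inner′ , inj₂ (inj₁ (refl , refl , refl))

  module _ (crossed : Crossed) where

    private
      u₀ u₁ u₂ w₀ w₁ w₂ : Vtx (suc (suc m))
      u₀ = (i , k)
      u₁ = (i , suc3 k)
      u₂ = (inc i , suc3 (suc3 k′))
      w₀ = (i , suc3 (suc3 k))
      w₁ = (inc i , k′)
      w₂ = (inc i , suc3 k′)

      CrossedPaths : Vtx (suc (suc m)) → Vtx (suc (suc m)) → Set
      CrossedPaths = TwoDipaths {u₀ = u₀} {u₁} {u₂} {w₀} {w₁} {w₂}

      u₁u₂-arc : s u₁ ≡ u₂
      u₁u₂-arc = cross-arc-to (suc3 k) (suc3-≢ k) (proj₁ crossed)

      w₀w₁-arc : s w₀ ≡ w₁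
      w₀w₁-arc = cross-arc-to (suc3 (suc3 k)) (suc3²-≢ k) (proj₂ crossed)

    crossed-distinct : Unique (u₀ ∷ u₁ ∷ u₂ ∷ w₀ ∷ w₁ ∷ w₂ ∷ [])
    crossed-distinct =
        (positions-differ (≢-sym (suc3-≢ k)) ∷ layers-differ
          ∷ positions-differ (≢-sym (suc3²-≢ k)) ∷ layers-differ ∷ layers-differ ∷ [])
      ∷ (layers-differ ∷ positions-differ (≢-sym (suc3-≢ (suc3 k)))
          ∷ layers-differ ∷ layers-differ ∷ [])
      ∷ (≢-sym layers-differ ∷ positions-differ (suc3²-≢ k′)
          ∷ positions-differ (suc3-≢ (suc3 k′)) ∷ [])
      ∷ (layers-differ ∷ layers-differ ∷ [])
      ∷ (positions-differ (≢-sym (suc3-≢ k′)) ∷ [])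
      ∷ [] ∷ []

    insub⇒crossedPaths : ∀ x y → InSub s i x y → CrossedPaths x y
    insub⇒crossedPaths (_ , c) _ (arc-c , inj₁ (refl , refl , refl))
      with inner-unique c arc-c
    ... | refl = inj₁ (refl , refl)
    insub⇒crossedPaths (_ , c) _ (arc-c , inj₂ (inj₁ (refl , refl , refl)))
      with inner′-unique c arc-c
    ... | refl = inj₂ (inj₂ (inj₂ (refl , refl)))
    insub⇒crossedPaths (_ , c) _ (arc-c , inj₂ (inj₂ (refl , refl)))
      with suc3-cases k c
    ... | inj₁ refl        = ⊥-elim (layers-differ (trans (sym inner) arc-c))
    ... | inj₂ (inj₁ refl) = inj₂ (inj₁ (refl , trans (sym arc-c) u₁u₂-arc))
    ... | inj₂ (inj₂ refl) = inj₂ (inj₂ (inj₁ (refl , trans (sym arc-c) w₀w₁-arc)))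

    crossedPaths⇒insub : ∀ x y → CrossedPaths x y → InSub s i x y
    crossedPaths⇒insub _ _ (inj₁ (refl , refl)) = inner , inj₁ (refl , refl , refl)
    crossedPaths⇒insub _ _ (inj₂ (inj₁ (refl , refl))) = u₁u₂-arc , inj₂ (inj₂ (refl , refl))
    crossedPaths⇒insub _ _ (inj₂ (inj₂ (inj₁ (refl , refl)))) = w₀w₁-arc , inj₂ (inj₂ (refl , refl))
    crossedPaths⇒insub _ _ (inj₂ (inj₂ (inj₂ (refl , refl)))) = inner′ , inj₂ (inj₁ (refl , refl , refl))

    crossed⇒switched : Switched s i
    crossed⇒switched = u₀ , u₁ , u₂ , w₀ , w₁ , w₂ , crossed-distinct ,
                       λ x y → insub⇒crossedPaths x y , crossedPaths⇒insub x y

  module _ (b : Bool) (sound : b ≡ true → Switched s i) (complete : Switched s i → b ≡ true) where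

    switch-bit : (Straight × b ≡ false) ⊎ (Crossed × b ≡ true)
    switch-bit with straight-or-crossed
    ... | inj₁ straight = inj₁ (straight , ¬-not (straight⇒¬switched straight ∘ sound))
    ... | inj₂ crossed  = inj₂ (crossed , complete (crossed⇒switched crossed))

    strand-across : ∀ c → proj₁ (s (i , c)) ≡ inc i → strand k′ (cross c) ≡ strand k c xor b
    strand-across c next with suc3-cases k c | switch-bit
    ... | inj₁ refl        | _ = ⊥-elim (≢-inc i (trans (sym (cong proj₁ inner)) next))
    ... | inj₂ (inj₁ refl) | inj₁ ((straight , _) , refl)
      rewrite straight | strand-self k′ | strand-suc3 k = refl
    ... | inj₂ (inj₂ refl) | inj₁ ((_ , straight) , refl)
      rewrite straight | strand-suc3² k′ | strand-suc3² k = refl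
    ... | inj₂ (inj₁ refl) | inj₂ ((crossed , _) , refl)
      rewrite crossed | strand-suc3² k′ | strand-suc3 k = refl
    ... | inj₂ (inj₂ refl) | inj₂ ((_ , crossed) , refl)
      rewrite crossed | strand-self k′ | strand-suc3² k = refl

module TypeOneFactor {m} (s : Vtx (suc (suc m)) → Vtx (suc (suc m)))
  (two-factor : IsTwoFactor s) (hamiltonian : IsHamiltonian s)
  (κ : Fin (suc (suc m)) → Fin 3)
  (inner : ∀ i → s (i , κ i) ≡ (i , suc3 (κ i)))
  (inner-unique : ∀ i c → s (i , c) ≡ (i , suc3 c) → c ≡ κ i)
  (switched : Fin (suc (suc m)) → Bool)
  (switched-sound : ∀ i → switched i ≡ true → Switched s i)
  (switched-complete : ∀ i → Switched s i → switched i ≡ true)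
  where

  private
    N : ℕ
    N = suc (suc m)

  switch-parity : ℕ → Bool
  switch-parity = xorUpTo (λ t → switched (t mod N))

  module _ (even : switch-parity N ≡ false) where

    OnStrand : Vtx N → Set
    OnStrand (i , c) = strand (κ i) c ≡ switch-parity (toℕ i)

    on-strand-step : ∀ v → OnStrand v → OnStrand (s v)
    on-strand-step (i , c) on with proj₁ two-factor (i , c)
    ... | inj₁ next = subst OnStrand (sym (cong (_, cross c) next)) (begin
      strand (κ (inc i)) (cross c)            ≡⟨ strand-across (switched i) (switched-sound i)
                                                                 (switched-complete i) c next ⟩
      strand (κ i) c xor switched i           ≡⟨ cong₂ _xor_ on (cong switched (sym (toℕ-mod i))) ⟩
      switch-parity (suc (toℕ i))             ≡⟨ periodic-toℕ-inc switch-parity even i ⟩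
      switch-parity (toℕ (inc i))             ∎)
      where open TypeOneLayer s two-factor i (inner i) (inner-unique i)
                                            (inner (inc i)) (inner-unique (inc i))
    ... | inj₂ (same , succ) = subst OnStrand (sym inner-arc) (begin
      strand (κ i) (suc3 c)      ≡⟨ cong (λ c′ → strand (κ i) (suc3 c′)) c≡κ ⟩
      strand (κ i) (suc3 (κ i))  ≡⟨ strand-suc3 (κ i) ⟩
      false                      ≡⟨ strand-self (κ i) ⟨
      strand (κ i) (κ i)         ≡⟨ cong (strand (κ i)) c≡κ ⟨
      strand (κ i) c             ≡⟨ on ⟩
      switch-parity (toℕ i)      ∎)
      where
      inner-arc : s (i , c) ≡ (i , suc3 c)
      inner-arc = cong₂ _,_ (sym same) succ
      c≡κ : c ≡ κ i
      c≡κ = inner-unique i c inner-arc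

  switch-parity-odd : switch-parity N ≡ true
  switch-parity-odd = ¬-not λ even →
    not-¬ (strand-suc3² (κ 0F))
      (hamiltonian-invariant hamiltonian (OnStrand even) (on-strand-step even)
        (0F , κ 0F) (0F , suc3 (suc3 (κ 0F))) (strand-self (κ 0F)))

module TypeZeroFactor {m} (s : Vtx (suc (suc m)) → Vtx (suc (suc m)))
  (two-factor : IsTwoFactor s) (hamiltonian : IsHamiltonian s)
  (γ : Fin (suc (suc m)) → Fin 3 → Fin 3)
  (arc : ∀ i c → s (i , c) ≡ (inc i , γ i c))
  where

  private
    N : ℕ
    N = suc (suc m)

    γ-at : ℕ → Fin 3 → Fin 3
    γ-at t = γ (t mod N)

  holonomy : Fin 3 → Fin 3
  holonomy = composeUpTo γ-at N

  γ-injective : ∀ i → Injective _≡_ _≡_ (γ i)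
  γ-injective i {x} {y} eq = ,-injectiveʳ (proj₂ two-factor (begin
    s (i , x)        ≡⟨ arc i x ⟩
    (inc i , γ i x)  ≡⟨ cong (inc i ,_) eq ⟩
    (inc i , γ i y)  ≡⟨ arc i y ⟨
    s (i , y)        ∎))

  holonomy-fixedPointFree : ∀ x → holonomy x ≢ x
  holonomy-fixedPointFree x fixed =
    suc3-≢ x (hamiltonian-invariant hamiltonian OnOrbit step (0F , x) (0F , suc3 x) refl)
    where
    OnOrbit : Vtx N → Set
    OnOrbit (i , c) = c ≡ composeUpTo γ-at (toℕ i) x

    step : ∀ v → OnOrbit v → OnOrbit (s v)
    step (i , c) on = subst OnOrbit (sym (arc i c)) (begin
      γ i c                               ≡⟨ cong₂ γ (sym (toℕ-mod i)) on ⟩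
      composeUpTo γ-at (suc (toℕ i)) x    ≡⟨ periodic-toℕ-inc (λ t → composeUpTo γ-at t x) fixed i ⟩
      composeUpTo γ-at (toℕ (inc i)) x    ∎)

  holonomy-rotation : Rotation holonomy
  holonomy-rotation = fixedPointFree⇒rotation holonomy
    (composeUpTo-injective (γ-injective ∘ (_mod N)) N) holonomy-fixedPointFree

module HamiltonianDecomposition {m} (F : Fin 4 → Vtx (suc (suc m)) → Vtx (suc (suc m)))
  (two-factor : ∀ j → IsTwoFactor (F j))
  (type-one : ∀ (j : Fin 3) → TypeOne (F (inject₁ j)))
  (starts : ∀ (j : Fin 3) → F (inject₁ j) (0F , j) ≡ (0F , suc3 j))
  (k : Fin (suc (suc m)) → Fin 3 → Fin 3)
  (inner : ∀ i j → F (inject₁ j) (i , k i j) ≡ (i , suc3 (k i j)))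
  (σ : Fin (suc (suc m)) → Fin 3 → Fin 3)
  (σ-k : ∀ i j → σ i (k i j) ≡ k (inc i) j)
  (γ : Fin (suc (suc m)) → Fin 3 → Fin 3)
  (γ-arc : ∀ i j → F 3F (i , j) ≡ (inc i , γ i j))
  (a : Fin (suc (suc m)) → Fin 3 → Bool)
  (a-switched : ∀ i j → (a i (k i j) ≡ true → Switched (F (inject₁ j)) i)
                      × (Switched (F (inject₁ j)) i → a i (k i j) ≡ true))
  (hamiltonian : ∀ j → IsHamiltonian (F j))
  where

  private
    N : ℕ
    N = suc (suc m)

  g : ℕ → Γ
  g t = ⟨ a (t mod N) , σ (t mod N) , γ (t mod N) ⟩

  inner-unique : ∀ j i c → F (inject₁ j) (i , c) ≡ (i , suc3 c) → c ≡ k i j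
  inner-unique j i c arc with type-one j i
  ... | _ , _ , unique = trans (unique c arc) (sym (unique (k i j) (inner i j)))

  k-zero : ∀ j → k 0F j ≡ j
  k-zero j = sym (inner-unique j 0F j (starts j))

  k-chain : ∀ t j → σ (t mod N) (k (t mod N) j) ≡ k (suc t mod N) j
  k-chain t j = trans (σ-k (t mod N) j) (cong (λ i → k i j) (inc-mod t))

  sig-product : ∀ j → sig (prodUpTo g N) j ≡ j
  sig-product j = begin
    sig (prodUpTo g N) j        ≡⟨ cong (sig (prodUpTo g N)) (k-zero j) ⟨
    sig (prodUpTo g N) (k 0F j) ≡⟨ sig-prodUpTo-chain g (λ t → k (t mod N)) k-chain N j ⟩
    k (N mod N) j               ≡⟨ cong (λ i → k i j) n-mod-n≡0 ⟩
    k 0F j                      ≡⟨ k-zero j ⟩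
    j                           ∎

  vec-product : ∀ j → vec (prodUpTo g N) j ≡ true
  vec-product j = begin
    vec (prodUpTo g N) j        ≡⟨ cong (vec (prodUpTo g N)) (k-zero j) ⟨
    vec (prodUpTo g N) (k 0F j) ≡⟨ vec-prodUpTo-chain g (λ t → k (t mod N)) k-chain N j ⟩
    switch-parity N             ≡⟨ switch-parity-odd ⟩
    true                        ∎
    where
    open TypeOneFactor (F (inject₁ j)) (two-factor (inject₁ j)) (hamiltonian (inject₁ j))
      (λ i → k i j) (λ i → inner i j) (inner-unique j) (λ i → a i (k i j))
      (λ i → proj₁ (a-switched i j)) (λ i → proj₂ (a-switched i j))

  gam-product : Rotation (gam (prodUpTo g N))
  gam-product = Sum.map (λ rotates x → trans (gam-prodUpTo g N x) (rotates x))
                        (λ rotates x → trans (gam-prodUpTo g N x) (rotates x))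
                        holonomy-rotation
    where open TypeZeroFactor (F 3F) (two-factor 3F) (hamiltonian 3F) γ γ-arc

-- The arc-partition and type-0 hypotheses are not needed: the description of F₃ by the γ_i
-- already says that no arc of F₃ stays inside a layer.
lemma6p22 : (m : ℕ) →
    -- n = m + 2 ≥ 2; F j (j : Fin 4) is the successor map of the 2-factor F_j
    (F : Fin 4 → Vtx (suc (suc m)) → Vtx (suc (suc m))) →
    (∀ j → IsTwoFactor (F j)) →
    IsArcPartition F →
    (∀ (j : Fin 3) → TypeOne (F (inject₁ j))) →
    TypeZero (F (suc (suc (suc zero)))) →
    (∀ (j : Fin 3) → F (inject₁ j) (zero , j) ≡ (zero , suc3 j)) →
    -- k i j = k_(i,j)
    (k : Fin (suc (suc m)) → Fin 3 → Fin 3) →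
    (∀ i j → F (inject₁ j) (i , k i j) ≡ (i , suc3 (k i j))) →
    -- σ i = σ_i
    (σ : Fin (suc (suc m)) → Fin 3 → Fin 3) →
    (∀ i j → σ i (k i j) ≡ k (inc i) j) →
    -- γ i = γ_i
    (γ : Fin (suc (suc m)) → Fin 3 → Fin 3) →
    (∀ i j → F (suc (suc (suc zero))) (i , j) ≡ (inc i , γ i j)) →
    -- a i k = a^i_k
    (a : Fin (suc (suc m)) → Fin 3 → Bool) →
    (∀ i j → (a i (k i j) ≡ true → Switched (F (inject₁ j)) i)
           × (Switched (F (inject₁ j)) i → a i (k i j) ≡ true)) →
    -- hamiltonian decomposition
    (∀ j → IsHamiltonian (F j)) →
    IsTargetElement (prodΓ (suc (suc m)) (λ i → ⟨ a i , σ i , γ i ⟩))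
lemma6p22 m F two-factor _ type-one _ starts k inner σ σ-k γ γ-arc a a-switched hamiltonian =
  subst IsTargetElement (sym (prodΓ≡prodUpTo (suc m) (λ i → ⟨ a i , σ i , γ i ⟩)))
        (vec-product , sig-product , gam-product)
  where
  open HamiltonianDecomposition F two-factor type-one starts k inner σ σ-k γ γ-arc a a-switched
                                hamiltonian
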